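{- Let $d\ge2$, $k\ge1$, let $\Gamma$ be a subtree of $T_k$, and let $D_\Gamma$ be the $\mathcal D$-class of $\mathrm{PAut}_c(T_k)$ consisting of all $\sigma$ with $\mathrm{dom}(\sigma)\cong\Gamma$. Then the number of idempotents in $D_\Gamma$ is $$|E(D_\Gamma)|=\frac{(d!)^{\frac{1-d^k}{1-d}}}{|St_{T_k}(\Gamma)|}.$$
   Context: $T_k$ is the rooted $k$-level $d$-regular tree (root at level 0, every vertex at level $<k$ has exactly $d$ children). A subtree means a connected subgraph containing the root. $\mathrm{PAut}_c(T_k)$ is the semigroup of injective partial maps $\varphi$ of the vertex set of $T_k$ that are graph isomorphisms between the subgraphs induced on domain and range, whose domain induces a connected subgraph containing the root, and which preserve vertex levels; composition is $(\varphi\psi)(x)=\psi(\varphi(x))$. $\mathrm{dom}(\sigma)\cong\Gamma$ means isomorphism as rooted trees. $St_{T_k}(\Gamma)$ is the setwise stabilizer of $\Gamma$ in $\mathrm{Aut}\,T_k$. $E(D_\Gamma)$ is the set of idempotents in $D_\Gamma$. -}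

module Defs where

open import Data.Nat using (ℕ; zero; suc; _+_; _*_; _^_; _≤_; z≤n; _!)
open import Data.Fin using (Fin)
open import Data.List using (List; []; _∷_; length)
open import Data.Maybe using (Maybe; just; nothing; _>>=_)
open import Data.Bool using (Bool; T)
open import Data.Product using (Σ; Σ-syntax; ∃; _×_; _,_; proj₁; proj₂)
open import Data.Sum using (_⊎_)
open import Function.Bundles using (_⇔_)
open import Relation.Binary.PropositionalEquality using (_≡_; refl; sym; trans)
open import Relation.Binary.Bundles using (Setoid)

module _ (d k : ℕ) where

  -- A word is read
  -- right-to-left: the children of w are i ∷ w (i : Fin d), the parent of
  -- i ∷ w is w.
  Vert : Set
  Vert = Σ[ w ∈ List (Fin d) ] length w ≤ k

  root : Vert
  root = [] , z≤n

  level : Vert → ℕ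
  level x = length (proj₁ x)

  Adj : Vert → Vert → Set
  Adj x y = (∃ λ (i : Fin d) → proj₁ y ≡ i ∷ proj₁ x)
          ⊎ (∃ λ (i : Fin d) → proj₁ x ≡ i ∷ proj₁ y)

  data Walk (P : Vert → Set) : Vert → Vert → Set where
    here : ∀ {x} → P x → Walk P x x
    step : ∀ {x y z} → P x → Adj x y → Walk P y z → Walk P x z

  Connected : (Vert → Set) → Set
  Connected P = ∀ x y → P x → P y → Walk P x y

  IsSubtree : (Vert → Set) → Set
  IsSubtree P = P root × Connected P

  record RootedIso (P Q : Vert → Set) : Set where
    field
      f    : ∀ x → P x → Vert
      f∈   : ∀ x (p : P x) → Q (f x p)
      g    : ∀ y → Q y → Vert
      g∈   : ∀ y (q : Q y) → P (g y q)
      gf   : ∀ x (p : P x) → g (f x p) (f∈ x p) ≡ x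
      fg   : ∀ y (q : Q y) → f (g y q) (g∈ y q) ≡ y
      adj  : ∀ x (p : P x) y (q : P y) → Adj x y ⇔ Adj (f x p) (f y q)
      root↦ : (p : P root) → f root p ≡ root

  PMap : Set
  PMap = Vert → Maybe Vert

  Dom : PMap → Vert → Set
  Dom φ x = ∃ λ y → φ x ≡ just y

  -- composition (φψ)(x) = ψ(φ(x))
  _∙_ : PMap → PMap → PMap
  (φ ∙ ψ) x = φ x >>= ψ

  record IsPAutc (φ : PMap) : Set where
    field
      injective : ∀ x y z → φ x ≡ just z → φ y ≡ just z → x ≡ y
      iso       : ∀ x y x' y' → φ x ≡ just x' → φ y ≡ just y' →
                  Adj x y ⇔ Adj x' y'
      levelPres : ∀ x y → φ x ≡ just y → level y ≡ level x
      domSub    : IsSubtree (Dom φ)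

  Idempotent : PMap → Set
  Idempotent φ = ∀ x → (φ ∙ φ) x ≡ φ x

  InD : (Vert → Bool) → PMap → Set
  InD Γ σ = IsPAutc σ × RootedIso (Dom σ) (λ x → T (Γ x))

  E-D : (Vert → Bool) → Setoid _ _
  E-D Γ = record
    { Carrier = Σ[ σ ∈ PMap ] (InD Γ σ × Idempotent σ)
    ; _≈_ = λ a b → ∀ x → proj₁ a x ≡ proj₁ b x
    ; isEquivalence = record
      { refl = λ x → refl
      ; sym = λ p x → sym (p x)
      ; trans = λ p q x → trans (p x) (q x) } }

  record Aut : Set where
    field
      fun  : Vert → Vert
      inv  : Vert → Vert
      left  : ∀ x → inv (fun x) ≡ x
      right : ∀ x → fun (inv x) ≡ x
      adj  : ∀ x y → Adj x y ⇔ Adj (fun x) (fun y)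

  St : (Vert → Bool) → Setoid _ _
  St Γ = record
    { Carrier = Σ[ α ∈ Aut ] (∀ x → Γ (Aut.fun α x) ≡ Γ x)
    ; _≈_ = λ a b → ∀ x → Aut.fun (proj₁ a) x ≡ Aut.fun (proj₁ b) x
    ; isEquivalence = record
      { refl = λ x → refl
      ; sym = λ p x → sym (p x)
      ; trans = λ p q x → trans (p x) (q x) } }

-- 1 + d + ... + d^(k-1) = (1 - d^k)/(1 - d)
geom : ℕ → ℕ → ℕ
geom d zero = 0
geom d (suc k) = d ^ k + geom d k

-- An idempotent σ of PAut_c(T_k) is injective with σ (σ x) = σ x, hence the identity on its
-- domain, so E(D_Γ) is in bijection with the subtrees isomorphic to Γ. A rooted isomorphism between
-- subtrees extends to an automorphism of T_k: at each vertex, the partial injection it induces on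
-- the children extends to a permutation. Hence these subtrees form the orbit of Γ under Aut T_k, and
-- orbit–stabilizer gives |E(D_Γ)| · |St(Γ)| = |Aut T_k|. For d ≥ 2 and k ≥ 1 the root is the only
-- vertex of degree d, so it is fixed, and an automorphism is determined by its portrait: the
-- permutation it induces on the children of each of the 1 + d + ⋯ + d^(k-1) inner vertices.
-- Thus |Aut T_k| = (d!)^(1 + d + ⋯ + d^(k-1)).

module Submission where

open import Defs
open import Data.Nat using (ℕ; _*_; _^_; _≤_; _!)
open import Data.Fin using (Fin)
open import Data.Bool using (Bool; T)
open import Data.Product using (Σ; Σ-syntax; _×_)
open import Function.Bundles using (Inverse)
open import Relation.Binary.PropositionalEquality using (_≡_; setoid)

open import Data.Bool using (true; false; if_then_else_)
import Data.Bool.Properties as Bool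
open import Data.Empty using (⊥; ⊥-elim)
open import Data.Fin using (zero; suc; combine; remQuot; punchIn; punchOut)
import Data.Fin.Properties as Fin
open import Data.Fin.Permutation as Perm
  using (Permutation′; _⟨$⟩ʳ_; _⟨$⟩ˡ_; insert; remove; insert-punchIn; insert-remove; remove-insert)
open import Data.List using (List; []; _∷_; length)
import Data.List.Properties as List
open import Data.Maybe using (Maybe; just; nothing; is-just; _>>=_)
import Data.Maybe.Properties as Maybe
open import Data.Nat using (zero; suc; _+_; _<_; _<?_; _≤?_; z≤n; s≤s; s≤s⁻¹)
import Data.Nat.Properties as ℕ
open import Data.Product using (proj₁; proj₂; _,_; ∃; uncurry)
open import Data.Product.Function.NonDependent.Setoid using (_×-inverse_)
open import Data.Product.Relation.Binary.Pointwise.NonDependent using (_×ₛ_)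
open import Data.Sum using (_⊎_; inj₁; inj₂)
open import Data.Unit using (⊤; tt)
open import Data.Vec.Functional.Relation.Binary.Pointwise.Properties using () renaming (setoid to vecSetoid)
open import Function using (_∘_; id)
open import Function.Bundles using (_⇔_; mk⇔; Equivalence)
import Function.Construct.Composition as Comp
open import Function.Construct.Composition using (_⇔-∘_)
import Function.Construct.Identity as Id
import Function.Construct.Symmetry as Sym
open import Function.Construct.Symmetry using (⇔-sym)
open import Function.Indexed.Relation.Binary.Equality using (≡-setoid)
open import Relation.Binary.Bundles using (Setoid)
import Relation.Binary.Construct.On as On
open import Relation.Binary.Definitions using (_Respects_)
import Relation.Binary.Indexed.Heterogeneous.Construct.Trivial as Trivial
open import Relation.Binary.PropositionalEquality
  using (refl; sym; trans; cong; cong₂; subst; subst₂; _≢_; module ≡-Reasoning)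
open import Relation.Nullary using (Dec; yes; no; ¬_; Irrelevant)
open import Relation.Nullary.Decidable using (map′)
open import Relation.Unary using (Decidable)

open ≡-Reasoning

-- Finite setoids

infix 4 _↔Fin_
_↔Fin_ : ∀ {a ℓ} → Setoid a ℓ → ℕ → Set _
S ↔Fin n = Inverse S (setoid (Fin n))

infixr 9 _∘↔_
_∘↔_ : ∀ {a b c ℓ₁ ℓ₂ ℓ₃} {A : Setoid a ℓ₁} {B : Setoid b ℓ₂} {C : Setoid c ℓ₃} →
       Inverse B C → Inverse A B → Inverse A C
g ∘↔ f = Comp.inverse f g

module _ {a b ℓ₁ ℓ₂} {A : Setoid a ℓ₁} {B : Setoid b ℓ₂} where
  private
    module A = Setoid A
    module B = Setoid B

  mkInverse : (to : A.Carrier → B.Carrier) (from : B.Carrier → A.Carrier) →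
              (∀ {x y} → x A.≈ y → to x B.≈ to y) → (∀ {x y} → x B.≈ y → from x A.≈ from y) →
              (∀ y → to (from y) B.≈ y) → (∀ x → from (to x) A.≈ x) → Inverse A B
  mkInverse to from to-cong from-cong to∘from from∘to = record
    { to = to ; from = from ; to-cong = to-cong ; from-cong = from-cong
    ; inverse = (λ {x} eq → B.trans (to-cong eq) (to∘from x))
              , (λ {x} eq → A.trans (from-cong eq) (from∘to x)) }

↔Fin-unique : ∀ {a ℓ} {S : Setoid a ℓ} {m n} → S ↔Fin m → S ↔Fin n → m ≡ n
↔Fin-unique f g = Perm.↔⇒≡ (g ∘↔ Sym.inverse f)

↔Fin-resp : ∀ {a ℓ} {S : Setoid a ℓ} {m n} → m ≡ n → S ↔Fin m → S ↔Fin n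
↔Fin-resp refl f = f

infixr 5 _⇒ₛ_
_⇒ₛ_ : ∀ {b ℓ} → Set → Setoid b ℓ → Setoid _ _
V ⇒ₛ B = ≡-setoid V (Trivial.indexedSetoid B)

Subsetoid : ∀ {a ℓ} (A : Setoid a ℓ) → (Setoid.Carrier A → Set) → Setoid _ _
Subsetoid A P = On.setoid A (proj₁ {B = P})

PermSetoid : ℕ → Setoid _ _
PermSetoid n = On.setoid (Fin n ⇒ₛ setoid (Fin n)) _⟨$⟩ʳ_

×-↔Fin : ∀ {a b ℓ₁ ℓ₂} {A : Setoid a ℓ₁} {B : Setoid b ℓ₂} {m n} →
         A ↔Fin m → B ↔Fin n → (A ×ₛ B) ↔Fin (m * n)
×-↔Fin {m = m} {n} f g = pairs ∘↔ (f ×-inverse g)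
  where
  pairs : (setoid (Fin m) ×ₛ setoid (Fin n)) ↔Fin (m * n)
  pairs = mkInverse (uncurry combine) (remQuot n)
    (λ { (refl , refl) → refl }) (λ { refl → refl , refl })
    (Fin.combine-remQuot {m} n)
    (λ (i , j) → let eq = Fin.remQuot-combine i j in cong proj₁ eq , cong proj₂ eq)

vec-↔Fin : ∀ {b ℓ} {B : Setoid b ℓ} {m} n → B ↔Fin m → vecSetoid B n ↔Fin (m ^ n)
vec-↔Fin zero f = mkInverse (λ _ → zero) (λ _ ()) (λ _ → refl) (λ _ ()) (λ { zero → refl }) (λ _ ())
vec-↔Fin {B = B} (suc n) f = ×-↔Fin f (vec-↔Fin n f) ∘↔ head-tail
  where
  module B = Setoid B
  head-tail : Inverse (vecSetoid B (suc n)) (B ×ₛ vecSetoid B n)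
  head-tail = mkInverse (λ v → v zero , v ∘ suc) (λ { (x , v) zero → x ; (x , v) (suc i) → v i })
    (λ eq → eq zero , eq ∘ suc) (λ { (eq , _) zero → eq ; (_ , eq) (suc i) → eq i })
    (λ _ → B.refl , λ _ → B.refl) (λ { _ zero → B.refl ; _ (suc i) → B.refl })

⇒ₛ-↔Fin : ∀ {b ℓ} {V : Set} {B : Setoid b ℓ} {m n} →
          setoid V ↔Fin n → B ↔Fin m → (V ⇒ₛ B) ↔Fin (m ^ n)
⇒ₛ-↔Fin {B = B} {n = n} e f = vec-↔Fin n f ∘↔ reindex
  where
  module B = Setoid B
  module e = Inverse e
  reindex : Inverse (_ ⇒ₛ B) (vecSetoid B n)
  reindex = mkInverse (_∘ e.from) (_∘ e.to) (λ eq i → eq _) (λ eq x → eq _)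
    (λ v i → B.reflexive (cong v (e.strictlyInverseˡ i)))
    (λ v x → B.reflexive (cong v (e.strictlyInverseʳ x)))

punchOut-cong₂ : ∀ {n} {i i′ j j′ : Fin (suc n)} (p : i ≢ j) (q : i′ ≢ j′) →
                 i ≡ i′ → j ≡ j′ → punchOut p ≡ punchOut q
punchOut-cong₂ {i = i} _ _ refl = Fin.punchOut-cong i

-- A permutation of Fin (suc n) is its image of zero together with a permutation of Fin n.
perm-↔Fin : ∀ n → PermSetoid n ↔Fin (n !)
perm-↔Fin zero = mkInverse (λ _ → zero) (λ _ → Perm.id) (λ _ → refl) (λ _ ()) (λ { zero → refl }) (λ _ ())
perm-↔Fin (suc n) = ×-↔Fin (Id.inverse (setoid (Fin (suc n)))) (perm-↔Fin n) ∘↔ split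
  where
  insert-cong : ∀ j {π ρ : Permutation′ n} → (∀ i → π ⟨$⟩ʳ i ≡ ρ ⟨$⟩ʳ i) →
                ∀ i → insert zero j π ⟨$⟩ʳ i ≡ insert zero j ρ ⟨$⟩ʳ i
  insert-cong j eq zero = refl
  insert-cong j {π} {ρ} eq (suc i) = begin
    insert zero j π ⟨$⟩ʳ suc i   ≡⟨ insert-punchIn zero j π i ⟩
    punchIn j (π ⟨$⟩ʳ i)         ≡⟨ cong (punchIn j) (eq i) ⟩
    punchIn j (ρ ⟨$⟩ʳ i)         ≡⟨ insert-punchIn zero j ρ i ⟨
    insert zero j ρ ⟨$⟩ʳ suc i   ∎
  split : Inverse (PermSetoid (suc n)) (setoid (Fin (suc n)) ×ₛ PermSetoid n)
  split = mkInverse (λ π → π ⟨$⟩ʳ zero , remove zero π) (uncurry (insert zero))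
    (λ eq → eq zero , λ i → punchOut-cong₂ _ _ (eq zero) (eq (suc i)))
    (λ { {j , _} (refl , eq) → insert-cong j eq })
    (λ (j , π) → refl , remove-insert zero j π)
    (insert-remove zero)

module _ {n} {Q : Fin (suc n) → Set} {m} (tail : Subsetoid (setoid (Fin n)) (Q ∘ suc) ↔Fin m) where
  private module tail = Inverse tail

  subset-keep-zero : Q zero → Subsetoid (setoid (Fin (suc n))) Q ↔Fin suc m
  subset-keep-zero q₀ = mkInverse to from to-cong (λ { refl → refl }) to∘from from∘to
    where
    to : Σ (Fin (suc n)) Q → Fin (suc m)
    to (zero , _) = zero
    to (suc i , q) = suc (tail.to (i , q))
    from : Fin (suc m) → Σ (Fin (suc n)) Q
    from zero = zero , q₀
    from (suc j) = let (i , q) = tail.from j in suc i , q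
    to-cong : ∀ {x y} → proj₁ x ≡ proj₁ y → to x ≡ to y
    to-cong {zero , _} {zero , _} refl = refl
    to-cong {suc _ , _} {suc _ , _} refl = cong suc (tail.to-cong refl)
    to∘from : ∀ j → to (from j) ≡ j
    to∘from zero = refl
    to∘from (suc j) = cong suc (tail.strictlyInverseˡ j)
    from∘to : ∀ x → proj₁ (from (to x)) ≡ proj₁ x
    from∘to (zero , _) = refl
    from∘to (suc i , q) = cong suc (tail.strictlyInverseʳ (i , q))

  subset-skip-zero : ¬ Q zero → Subsetoid (setoid (Fin (suc n))) Q ↔Fin m
  subset-skip-zero ¬q₀ = mkInverse to from to-cong (λ { refl → refl }) tail.strictlyInverseˡ from∘to
    where
    to : Σ (Fin (suc n)) Q → Fin m
    to (zero , q) = ⊥-elim (¬q₀ q)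
    to (suc i , q) = tail.to (i , q)
    from : Fin m → Σ (Fin (suc n)) Q
    from j = let (i , q) = tail.from j in suc i , q
    to-cong : ∀ {x y} → proj₁ x ≡ proj₁ y → to x ≡ to y
    to-cong {zero , q} refl = ⊥-elim (¬q₀ q)
    to-cong {suc _ , _} {suc _ , _} refl = tail.to-cong refl
    from∘to : ∀ x → proj₁ (from (to x)) ≡ proj₁ x
    from∘to (zero , q) = ⊥-elim (¬q₀ q)
    from∘to (suc i , q) = cong suc (tail.strictlyInverseʳ (i , q))

Fin-subset-↔Fin : ∀ n {Q : Fin n → Set} → Decidable Q → ∃ λ m → Subsetoid (setoid (Fin n)) Q ↔Fin m
Fin-subset-↔Fin zero Q? = 0 , mkInverse (λ ()) (λ ()) (λ { {()} }) (λ { {()} }) (λ ()) (λ ())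
Fin-subset-↔Fin (suc n) Q? with Fin-subset-↔Fin n (Q? ∘ suc) | Q? zero
... | m , tail | yes q₀ = suc m , subset-keep-zero tail q₀
... | m , tail | no ¬q₀ = m , subset-skip-zero tail ¬q₀

subset-↔Fin : ∀ {a ℓ} (A : Setoid a ℓ) {n} {P : Setoid.Carrier A → Set} →
              P Respects Setoid._≈_ A → Decidable P → A ↔Fin n → ∃ λ m → Subsetoid A P ↔Fin m
subset-↔Fin A {n} {P} resp P? e =
  let (m , f) = Fin-subset-↔Fin n (P? ∘ e.from) in m , f ∘↔ transport
  where
  module A = Setoid A
  module e = Inverse e
  transport : Inverse (Subsetoid A P) (Subsetoid (setoid (Fin n)) (P ∘ e.from))
  transport = mkInverse (λ (x , p) → e.to x , resp (A.sym (e.strictlyInverseʳ x)) p)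
                        (λ (i , p) → e.from i , p)
                        e.to-cong e.from-cong
                        (e.strictlyInverseˡ ∘ proj₁) (e.strictlyInverseʳ ∘ proj₁)

all?-↔Fin : ∀ {V : Set} {n} {P : V → Set} → setoid V ↔Fin n → Decidable P → Dec (∀ x → P x)
all?-↔Fin {P = P} e P? = map′ (λ h x → subst P (e.strictlyInverseʳ x) (h (e.to x))) (λ h → h ∘ e.from)
                              (Fin.all? (P? ∘ e.from))
  where module e = Inverse e

any?-↔Fin : ∀ {a ℓ} (A : Setoid a ℓ) {n} {P : Setoid.Carrier A → Set} →
            P Respects Setoid._≈_ A → Decidable P → A ↔Fin n → Dec (∃ P)
any?-↔Fin A resp P? e = map′ (λ (i , p) → e.from i , p)
                             (λ (x , p) → e.to x , resp (Setoid.sym A (e.strictlyInverseʳ x)) p)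
                             (Fin.any? (P? ∘ e.from))
  where module e = Inverse e

-- Extending partial injections of Fin n to permutations

PartialInjection : ∀ {n} → (Fin n → Maybe (Fin n)) → Set
PartialInjection h = ∀ {i i′ j} → h i ≡ just j → h i′ ≡ just j → i ≡ i′

missed-value : ∀ {m} (h : Fin (suc m) → Maybe (Fin (suc m))) → PartialInjection h → h zero ≡ nothing →
               ∃ λ t → ∀ i → h i ≢ just t
missed-value {m} h inj h₀ = let (t , ¬hit) = Fin.¬∀⟶∃¬ _ _ hit? not-onto in t , λ i hit → ¬hit (i , hit)
  where
  hit? : ∀ t → Dec (∃ λ i → h i ≡ just t)
  hit? t = Fin.any? (λ i → Maybe.≡-dec Fin._≟_ (h i) (just t))
  -- If every value had a preimage, the preimages would inject Fin (suc m) into Fin (suc m) ∖ {zero}.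
  not-onto : ¬ (∀ t → ∃ λ i → h i ≡ just t)
  not-onto preimage = ℕ.<-irrefl refl (Fin.injective⇒≤ {f = shrunk} shrunk-injective)
    where
    pre≢0 : ∀ t → zero ≢ proj₁ (preimage t)
    pre≢0 t eq with () ← trans (sym h₀) (trans (cong h eq) (proj₂ (preimage t)))
    shrunk : Fin (suc m) → Fin m
    shrunk t = punchOut (pre≢0 t)
    shrunk-injective : ∀ {t t′} → shrunk t ≡ shrunk t′ → t ≡ t′
    shrunk-injective {t} {t′} eq = Maybe.just-injective (begin
      just t                          ≡⟨ proj₂ (preimage t) ⟨
      h (proj₁ (preimage t))          ≡⟨ cong h (Fin.punchOut-injective (pre≢0 t) (pre≢0 t′) eq) ⟩
      h (proj₁ (preimage t′))         ≡⟨ proj₂ (preimage t′) ⟩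
      just t′                         ∎)

zero-target : ∀ {m} (h : Fin (suc m) → Maybe (Fin (suc m))) → PartialInjection h →
              ∃ λ t → (∀ {j} → h zero ≡ just j → j ≡ t) × (∀ i → h (suc i) ≢ just t)
zero-target h inj with h zero in h₀
... | just t = t , (λ { refl → refl }) , λ i eq → Fin.0≢1+n (inj h₀ eq)
... | nothing = let (t , missed) = missed-value h inj h₀ in t , (λ ()) , missed ∘ suc

-- h on the nonzero points, with its image renumbered by removing t
module Shrink {m} (h : Fin (suc m) → Maybe (Fin (suc m))) (t : Fin (suc m)) (t-fresh : ∀ i → h (suc i) ≢ just t) where

  strip : ∀ i (r : Maybe (Fin (suc m))) → h (suc i) ≡ r → Maybe (Fin m)
  strip i nothing _ = nothing
  strip i (just j) eq = just (punchOut (λ t≡j → t-fresh i (trans eq (cong just (sym t≡j)))))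

  shrink : Fin m → Maybe (Fin m)
  shrink i = strip i (h (suc i)) refl

  strip-just : ∀ i r eq {j} → r ≡ just j → (t≢j : t ≢ j) → strip i r eq ≡ just (punchOut t≢j)
  strip-just i (just j) eq refl t≢j = cong just (Fin.punchOut-cong t refl)

  strip-inverse : ∀ i r eq {j} → strip i r eq ≡ just j → h (suc i) ≡ just (punchIn t j)
  strip-inverse i (just j) eq refl = trans eq (cong just (sym (Fin.punchIn-punchOut _)))

  shrink-just : ∀ {i j} → h (suc i) ≡ just j → (t≢j : t ≢ j) → shrink i ≡ just (punchOut t≢j)
  shrink-just {i} = strip-just i (h (suc i)) refl

  shrink-injective : PartialInjection h → PartialInjection shrink
  shrink-injective inj {i} {i′} eq eq′ =
    Fin.suc-injective (inj (strip-inverse i _ refl eq) (strip-inverse i′ _ refl eq′))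

partialInjection-extends : ∀ n (h : Fin n → Maybe (Fin n)) → PartialInjection h →
                           Σ (Permutation′ n) λ π → ∀ {i j} → h i ≡ just j → π ⟨$⟩ʳ i ≡ j
partialInjection-extends zero h inj = Perm.id , λ {i} → ⊥-elim (Fin.¬Fin0 i)
partialInjection-extends (suc m) h inj with zero-target h inj
... | t , t-zero , t-fresh = insert zero t ρ , extends
  where
  open Shrink h t t-fresh
  ρ-extends : Σ (Permutation′ m) λ ρ → ∀ {i j} → shrink i ≡ just j → ρ ⟨$⟩ʳ i ≡ j
  ρ-extends = partialInjection-extends m shrink (shrink-injective inj)
  ρ : Permutation′ m
  ρ = proj₁ ρ-extends
  extends : ∀ {i j} → h i ≡ just j → insert zero t ρ ⟨$⟩ʳ i ≡ j
  extends {zero} eq = sym (t-zero eq)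
  extends {suc i} {j} eq = begin
    insert zero t ρ ⟨$⟩ʳ suc i   ≡⟨ insert-punchIn zero t ρ i ⟩
    punchIn t (ρ ⟨$⟩ʳ i)         ≡⟨ cong (punchIn t) (proj₂ ρ-extends (shrink-just eq t≢j)) ⟩
    punchIn t (punchOut t≢j)     ≡⟨ Fin.punchIn-punchOut t≢j ⟩
    j                            ∎
    where t≢j : t ≢ j
          t≢j t≡j = t-fresh i (trans eq (cong just (sym t≡j)))

-- Words and vertices

bounded-≡ : ∀ {A : Set} {f : A → ℕ} {n} {x y : Σ A (λ a → f a ≤ n)} → proj₁ x ≡ proj₁ y → x ≡ y
bounded-≡ {x = a , p} {.a , q} refl = cong (a ,_) (ℕ.≤-irrelevant p q)

geom-suc : ∀ d n → suc (d * geom d n) ≡ geom d (suc n)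
geom-suc d zero = cong suc (ℕ.*-zeroʳ d)
geom-suc d (suc n) = begin
  suc (d * (d ^ n + geom d n))        ≡⟨ cong suc (ℕ.*-distribˡ-+ d (d ^ n) (geom d n)) ⟩
  suc (d ^ suc n + d * geom d n)      ≡⟨ ℕ.+-suc (d ^ suc n) (d * geom d n) ⟨
  d ^ suc n + suc (d * geom d n)      ≡⟨ cong (d ^ suc n +_) (geom-suc d n) ⟩
  d ^ suc n + geom d (suc n)          ∎

Word : ℕ → Set
Word d = List (Fin d)

Words< : ℕ → ℕ → Set
Words< d n = Σ (Word d) (λ w → length w < n)

words<-↔Fin : ∀ d n → setoid (Words< d n) ↔Fin geom d n
words<-↔Fin d zero = mkInverse (λ ()) (λ ()) (λ { {()} }) (λ { {()} }) (λ ()) (λ ())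
words<-↔Fin d (suc n) = ↔Fin-resp (geom-suc d n) (mkInverse to from (cong to) (cong from) to∘from from∘to)
  where
  module shorter = Inverse (words<-↔Fin d n)
  to : Words< d (suc n) → Fin (suc (d * geom d n))
  to ([] , _) = zero
  to (i ∷ w , s≤s p) = suc (combine i (shorter.to (w , p)))
  from : Fin (suc (d * geom d n)) → Words< d (suc n)
  from zero = [] , s≤s z≤n
  from (suc j) = let (i , j′) = remQuot (geom d n) j ; (w , p) = shorter.from j′ in i ∷ w , s≤s p
  to∘from : ∀ j → to (from j) ≡ j
  to∘from zero = refl
  to∘from (suc j) = let (i , j′) = remQuot {d} (geom d n) j in cong suc (begin
    combine i (shorter.to (shorter.from j′))   ≡⟨ cong (combine i) (shorter.strictlyInverseˡ j′) ⟩
    combine i j′                               ≡⟨ Fin.combine-remQuot {d} (geom d n) j ⟩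
    j                                          ∎)
  from∘to : ∀ x → from (to x) ≡ x
  from∘to ([] , s≤s z≤n) = refl
  from∘to (i ∷ w , s≤s p) =
    let eq = Fin.remQuot-combine i (shorter.to (w , p)) in
    bounded-≡ (cong₂ _∷_ (cong proj₁ eq)
                         (trans (cong (proj₁ ∘ shorter.from ∘ proj₂) eq)
                                (cong proj₁ (shorter.strictlyInverseʳ (w , p)))))

vert-↔Fin : ∀ d k → setoid (Vert d k) ↔Fin geom d (suc k)
vert-↔Fin d k = words<-↔Fin d (suc k) ∘↔ mkInverse (λ (w , p) → w , s≤s p) (λ (w , p) → w , s≤s⁻¹ p)
  (cong _) (cong _) (λ _ → bounded-≡ refl) (λ _ → bounded-≡ refl)

-- c ≼ w: the vertex c lies on the path from the root to w (c is a suffix of w).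
infix 4 _≼_
data _≼_ {A : Set} : List A → List A → Set where
  ≼-refl : ∀ {w} → w ≼ w
  ≼-∷ : ∀ {c w i} → c ≼ w → c ≼ i ∷ w

-- Automorphisms of T_k

module Automorphisms (d k : ℕ) where

  V : Set
  V = Vert d k

  walk-head : ∀ {P x y} → Walk d k P x y → P x
  walk-head (here p) = p
  walk-head (step p _ _) = p

  walk-map : (α : Aut d k) {P Q : V → Set} → (∀ {x} → P x → Q (Aut.fun α x)) →
             ∀ {a b} → Walk d k P a b → Walk d k Q (Aut.fun α a) (Aut.fun α b)
  walk-map α P⇒Q (here p) = here (P⇒Q p)
  walk-map α P⇒Q (step p a W) = step (P⇒Q p) (Equivalence.to (Aut.adj α _ _) a) (walk-map α P⇒Q W)

  AutSetoid : Setoid _ _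
  AutSetoid = On.setoid (V ⇒ₛ setoid V) Aut.fun

  infixr 9 _∘ᵃ_
  _∘ᵃ_ : Aut d k → Aut d k → Aut d k
  β ∘ᵃ α = record
    { fun = β.fun ∘ α.fun ; inv = α.inv ∘ β.inv
    ; left = λ x → trans (cong α.inv (β.left (α.fun x))) (α.left x)
    ; right = λ x → trans (cong β.fun (α.right (β.inv x))) (β.right x)
    ; adj = λ x y → β.adj (α.fun x) (α.fun y) ⇔-∘ α.adj x y }
    where module α = Aut α
          module β = Aut β

  _⁻¹ᵃ : Aut d k → Aut d k
  α ⁻¹ᵃ = record
    { fun = α.inv ; inv = α.fun ; left = α.right ; right = α.left
    ; adj = λ x y → ⇔-sym (subst₂ (λ a b → Adj d k (α.inv x) (α.inv y) ⇔ Adj d k a b) (α.right x) (α.right y)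
                                  (α.adj (α.inv x) (α.inv y))) }
    where module α = Aut α

  Neighbours : V → Setoid _ _
  Neighbours x = On.setoid {B = Σ V (Adj d k x)} (setoid (Word d)) (proj₁ ∘ proj₁)

  aut-neighbours : (α : Aut d k) → ∀ x → Inverse (Neighbours x) (Neighbours (Aut.fun α x))
  aut-neighbours α x = mkInverse
    (λ (y , a) → α.fun y , Equivalence.to (α.adj x y) a)
    (λ (y , a) → α.inv y , Equivalence.from (α.adj x (α.inv y)) (subst (Adj d k (α.fun x)) (sym (α.right y)) a))
    (λ eq → cong (proj₁ ∘ α.fun) (bounded-≡ eq)) (λ eq → cong (proj₁ ∘ α.inv) (bounded-≡ eq))
    (λ (y , _) → cong proj₁ (α.right y)) (λ (y , _) → cong proj₁ (α.left y))
    where module α = Aut α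

  root-neighbours-↔Fin : 1 ≤ k → Neighbours (root d k) ↔Fin d
  root-neighbours-↔Fin k≥1 = mkInverse to (λ i → (i ∷ [] , k≥1) , inj₁ (i , refl))
    (λ {a} {b} → to-cong {a} {b}) (λ { refl → refl }) (λ _ → refl) from∘to
    where
    to : Σ V (Adj d k (root d k)) → Fin d
    to (_ , inj₁ (i , _)) = i
    to-cong : ∀ {a b} → proj₁ (proj₁ a) ≡ proj₁ (proj₁ b) → to a ≡ to b
    to-cong {_ , inj₁ (_ , refl)} {_ , inj₁ (_ , refl)} eq = List.∷-injectiveˡ eq
    from∘to : ∀ a → to a ∷ [] ≡ proj₁ (proj₁ a)
    from∘to (_ , inj₁ (_ , refl)) = refl

  inner-neighbours-↔Fin : ∀ i w q → suc (suc (length w)) ≤ k → Neighbours (i ∷ w , q) ↔Fin suc d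
  inner-neighbours-↔Fin i w q h = mkInverse to from (λ {a} {b} → to-cong {a} {b}) (λ { refl → refl }) to∘from from∘to
    where
    to : Σ V (Adj d k (i ∷ w , q)) → Fin (suc d)
    to (_ , inj₁ (j , _)) = suc j
    to (_ , inj₂ _) = zero
    from : Fin (suc d) → Σ V (Adj d k (i ∷ w , q))
    from zero = (w , ℕ.<⇒≤ q) , inj₂ (i , refl)
    from (suc j) = (j ∷ i ∷ w , h) , inj₁ (j , refl)
    to-cong : ∀ {a b} → proj₁ (proj₁ a) ≡ proj₁ (proj₁ b) → to a ≡ to b
    to-cong {_ , inj₁ (_ , refl)} {_ , inj₁ (_ , refl)} eq = cong suc (List.∷-injectiveˡ eq)
    to-cong {_ , inj₂ _} {_ , inj₂ _} _ = refl
    to-cong {_ , inj₁ (_ , refl)} {_ , inj₂ (_ , refl)} eq = ⊥-elim (ℕ.m≢1+n+m _ (sym (cong length eq)))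
    to-cong {_ , inj₂ (_ , refl)} {_ , inj₁ (_ , refl)} eq = ⊥-elim (ℕ.m≢1+n+m _ (cong length eq))
    to∘from : ∀ j → to (from j) ≡ j
    to∘from zero = refl
    to∘from (suc j) = refl
    from∘to : ∀ a → proj₁ (proj₁ (from (to a))) ≡ proj₁ (proj₁ a)
    from∘to (_ , inj₁ (_ , refl)) = refl
    from∘to (_ , inj₂ (_ , refl)) = refl

  leaf-neighbours-↔Fin : ∀ i w q → ¬ (suc (suc (length w)) ≤ k) → Neighbours (i ∷ w , q) ↔Fin 1
  leaf-neighbours-↔Fin i w q ¬h = mkInverse (λ _ → zero) (λ _ → (w , ℕ.<⇒≤ q) , inj₂ (i , refl))
    (λ _ → refl) (λ _ → refl) (λ { zero → refl }) from∘to
    where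
    from∘to : ∀ a → w ≡ proj₁ (proj₁ a)
    from∘to ((_ , p) , inj₁ (_ , refl)) = ⊥-elim (¬h p)
    from∘to (_ , inj₂ (_ , refl)) = refl

  -- The root is the only vertex of degree d: inner vertices have degree d + 1, leaves degree 1 < d.
  degree-d⇒root : 2 ≤ d → 1 ≤ k → ∀ x → Inverse (Neighbours (root d k)) (Neighbours x) → proj₁ x ≡ []
  degree-d⇒root d≥2 k≥1 ([] , _) e = refl
  degree-d⇒root d≥2 k≥1 (i ∷ w , q) e = ⊥-elim (not-degree-d (suc (suc (length w)) ≤? k))
    where
    degree-d : Neighbours (i ∷ w , q) ↔Fin d
    degree-d = root-neighbours-↔Fin k≥1 ∘↔ Sym.inverse e
    not-degree-d : Dec (suc (suc (length w)) ≤ k) → ⊥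
    not-degree-d (yes h) = ℕ.1+n≢n (↔Fin-unique (inner-neighbours-↔Fin i w q h) degree-d)
    not-degree-d (no ¬h) = ℕ.<⇒≢ d≥2 (↔Fin-unique (leaf-neighbours-↔Fin i w q ¬h) degree-d)

  aut-fixes-root : 2 ≤ d → 1 ≤ k → (α : Aut d k) → ∀ {q} → proj₁ (Aut.fun α ([] , q)) ≡ []
  aut-fixes-root d≥2 k≥1 α {z≤n} = degree-d⇒root d≥2 k≥1 (Aut.fun α (root d k)) (aut-neighbours α (root d k))

  ParentClosed : (V → Set) → Set
  ParentClosed P = ∀ {i w} q → P (i ∷ w , q) → P (w , ℕ.<⇒≤ q)

  walk-ancestors : ∀ {P a b} → Walk d k P a b → ∀ c → proj₁ c ≼ proj₁ b → proj₁ c ≼ proj₁ a ⊎ P c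
  walk-ancestors (here _) c c≼b = inj₁ c≼b
  walk-ancestors {P} (step _ (inj₁ (i , refl)) W) c c≼b with walk-ancestors W c c≼b
  ... | inj₂ pc = inj₂ pc
  ... | inj₁ ≼-refl = inj₂ (subst P (bounded-≡ refl) (walk-head W))
  ... | inj₁ (≼-∷ c≼a) = inj₁ c≼a
  walk-ancestors (step _ (inj₂ (i , refl)) W) c c≼b with walk-ancestors W c c≼b
  ... | inj₂ pc = inj₂ pc
  ... | inj₁ c≼a = inj₁ (≼-∷ c≼a)

  subtree-parentClosed : ∀ {P} → IsSubtree d k P → ParentClosed P
  subtree-parentClosed {P} (p-root , connected) {i} {w} q p
    with walk-ancestors (connected (root d k) (i ∷ w , q) p-root p) (w , ℕ.<⇒≤ q) (≼-∷ ≼-refl)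
  ... | inj₁ ≼-refl = subst P (bounded-≡ refl) p-root
  ... | inj₂ pw = pw

  module RootedEmbedding {P : V → Set} (closed : ParentClosed P) (f : ∀ x → P x → V)
    (injective : ∀ {x y} p q → proj₁ (f x p) ≡ proj₁ (f y q) → proj₁ x ≡ proj₁ y)
    (adjacent : ∀ {x y} p q → Adj d k x y → Adj d k (f x p) (f y q))
    (root↦root : ∀ {q} p → proj₁ (f ([] , q) p) ≡ [])
    where

    -- f x is adjacent to the image of the parent of x; were it the parent of that image, the
    -- images of x and of its grandparent would coincide.
    child↦child : ∀ i w q (p : P (i ∷ w , q)) →
                  ∃ λ j → proj₁ (f (i ∷ w , q) p) ≡ j ∷ proj₁ (f (w , _) (closed q p))
    child↦child i w q p with adjacent (closed q p) p (inj₁ (i , refl))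
    ... | inj₁ (j , eq) = j , eq
    child↦child i [] q p | inj₂ (j , eq) with () ← trans (sym (root↦root _)) eq
    child↦child i (i′ ∷ w) q p | inj₂ (j , eq) =
      let (j′ , eq′) = child↦child i′ w _ (closed q p) in
      ⊥-elim (ℕ.m≢1+n+m _ (sym (cong length (injective _ _ (List.∷-injectiveʳ (trans (sym eq) eq′))))))

    length-preserved : ∀ w q (p : P (w , q)) → length (proj₁ (f (w , q) p)) ≡ length w
    length-preserved [] _ p = cong length (root↦root p)
    length-preserved (i ∷ w) q p =
      let (j , eq) = child↦child i w q p in trans (cong length eq) (cong suc (length-preserved w _ _))

  aut-injective : (α : Aut d k) {x y : V} → proj₁ (Aut.fun α x) ≡ proj₁ (Aut.fun α y) → proj₁ x ≡ proj₁ y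
  aut-injective α {x} {y} eq = cong proj₁ (begin
    x                     ≡⟨ α.left x ⟨
    α.inv (α.fun x)       ≡⟨ cong α.inv (bounded-≡ eq) ⟩
    α.inv (α.fun y)       ≡⟨ α.left y ⟩
    y                     ∎)
    where module α = Aut α

  module Relabel (ℓ : Word d → Permutation′ d) where

    relabel : Word d → Word d
    relabel [] = []
    relabel (i ∷ w) = (ℓ w ⟨$⟩ʳ i) ∷ relabel w

    unrelabel : Word d → Word d
    unrelabel [] = []
    unrelabel (j ∷ v) = (ℓ (unrelabel v) ⟨$⟩ˡ j) ∷ unrelabel v

    unrelabel-relabel : ∀ w → unrelabel (relabel w) ≡ w
    unrelabel-relabel [] = refl
    unrelabel-relabel (i ∷ w) rewrite unrelabel-relabel w = cong (_∷ w) (Perm.inverseˡ (ℓ w))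

    relabel-unrelabel : ∀ v → relabel (unrelabel v) ≡ v
    relabel-unrelabel [] = refl
    relabel-unrelabel (j ∷ v) = cong₂ _∷_ (Perm.inverseʳ (ℓ (unrelabel v))) (relabel-unrelabel v)

    length-relabel : ∀ w → length (relabel w) ≡ length w
    length-relabel [] = refl
    length-relabel (i ∷ w) = cong suc (length-relabel w)

    length-unrelabel : ∀ v → length (unrelabel v) ≡ length v
    length-unrelabel [] = refl
    length-unrelabel (j ∷ v) = cong suc (length-unrelabel v)

    parent-back : ∀ {w v j} → relabel v ≡ j ∷ relabel w → v ≡ (ℓ w ⟨$⟩ˡ j) ∷ w
    parent-back {w} {v} {j} eq = begin
      v                           ≡⟨ unrelabel-relabel v ⟨
      unrelabel (relabel v)       ≡⟨ cong unrelabel eq ⟩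
      unrelabel (j ∷ relabel w)   ≡⟨ cong (λ u → (ℓ u ⟨$⟩ˡ j) ∷ u) (unrelabel-relabel w) ⟩
      (ℓ w ⟨$⟩ˡ j) ∷ w            ∎

    relabelAut : Aut d k
    relabelAut = record
      { fun = λ (w , p) → relabel w , subst (_≤ k) (sym (length-relabel w)) p
      ; inv = λ (v , p) → unrelabel v , subst (_≤ k) (sym (length-unrelabel v)) p
      ; left = λ (w , _) → bounded-≡ (unrelabel-relabel w)
      ; right = λ (v , _) → bounded-≡ (relabel-unrelabel v)
      ; adj = λ _ _ → mk⇔
          (λ { (inj₁ (_ , eq)) → inj₁ (_ , cong relabel eq) ; (inj₂ (_ , eq)) → inj₂ (_ , cong relabel eq) })
          (λ { (inj₁ (_ , eq)) → inj₁ (_ , parent-back eq) ; (inj₂ (_ , eq)) → inj₂ (_ , parent-back eq) }) }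

  relabel-cong : ∀ {ℓ ℓ′ : Word d → Permutation′ d} →
                 (∀ w → length w < k → ∀ i → ℓ w ⟨$⟩ʳ i ≡ ℓ′ w ⟨$⟩ʳ i) →
                 ∀ w → length w ≤ k → Relabel.relabel ℓ w ≡ Relabel.relabel ℓ′ w
  relabel-cong eq [] _ = refl
  relabel-cong eq (i ∷ w) p = cong₂ _∷_ (eq w p i) (relabel-cong eq w (ℕ.<⇒≤ p))

  Portrait : Setoid _ _
  Portrait = Words< d k ⇒ₛ PermSetoid d

  portrait-↔Fin : Portrait ↔Fin (d !) ^ geom d k
  portrait-↔Fin = ⇒ₛ-↔Fin (words<-↔Fin d k) (perm-↔Fin d)

  -- A portrait labels only the vertices that have children; the leaves get the identity.
  labelling : (Words< d k → Permutation′ d) → Word d → Permutation′ d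
  labelling q w with length w <? k
  ... | yes p = q (w , p)
  ... | no _ = Perm.id

  labelling-inner : ∀ q w p → labelling q w ≡ q (w , p)
  labelling-inner q w p with length w <? k
  ... | yes p′ = cong q (bounded-≡ refl)
  ... | no ¬p = ⊥-elim (¬p p)

  portraitAut : (Words< d k → Permutation′ d) → Aut d k
  portraitAut q = Relabel.relabelAut (labelling q)

  module ExtendRootedIso {P Q : V → Set} (P? : Decidable P)
    (P-irrelevant : ∀ {x} → Irrelevant (P x)) (Q-irrelevant : ∀ {y} → Irrelevant (Q y))
    (closed : ParentClosed P) (R : RootedIso d k P Q) where

    module R = RootedIso R

    f-cong : ∀ {x x′} → x ≡ x′ → (p : P x) (p′ : P x′) → R.f x p ≡ R.f x′ p′
    f-cong refl p p′ = cong (R.f _) (P-irrelevant p p′)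

    f-injective : ∀ {x y} p q → proj₁ (R.f x p) ≡ proj₁ (R.f y q) → proj₁ x ≡ proj₁ y
    f-injective {x} {y} p q eq = cong proj₁ (begin
      x                         ≡⟨ R.gf x p ⟨
      R.g (R.f x p) (R.f∈ x p)  ≡⟨ g-cong (bounded-≡ eq) ⟩
      R.g (R.f y q) (R.f∈ y q)  ≡⟨ R.gf y q ⟩
      y                         ∎)
      where g-cong : ∀ {y y′} → y ≡ y′ → {q : Q y} {q′ : Q y′} → R.g y q ≡ R.g y′ q′
            g-cong refl = cong (R.g _) (Q-irrelevant _ _)

    root↦root : ∀ {q} p → proj₁ (R.f ([] , q) p) ≡ []
    root↦root {z≤n} p = cong proj₁ (R.root↦ p)

    open RootedEmbedding closed R.f f-injective (λ p q → Equivalence.to (R.adj _ p _ q)) root↦root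

    childHead : ∀ i w q → Dec (P (i ∷ w , q)) → Maybe (Fin d)
    childHead i w q (yes p) = just (proj₁ (child↦child i w q p))
    childHead i w q (no _) = nothing

    childHead-yes : ∀ i w q D (p : P (i ∷ w , q)) → childHead i w q D ≡ just (proj₁ (child↦child i w q p))
    childHead-yes i w q (yes p′) p = cong (just ∘ proj₁ ∘ child↦child i w q) (P-irrelevant p′ p)
    childHead-yes i w q (no ¬p) p = ⊥-elim (¬p p)

    childHead-just : ∀ i w q D {j} → childHead i w q D ≡ just j →
                     Σ (P (i ∷ w , q)) λ p → proj₁ (child↦child i w q p) ≡ j
    childHead-just i w q (yes p) refl = p , refl

    localPartial : Words< d k → Fin d → Maybe (Fin d)
    localPartial (w , q) i = childHead i w q (P? (i ∷ w , q))

    -- Children of w in P with the same image head have the same image, since they share the parent w.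
    localPartial-injective : ∀ u → PartialInjection (localPartial u)
    localPartial-injective (w , q) {i} {i′} {j} eq eq′ with childHead-just i w q _ eq | childHead-just i′ w q _ eq′
    ... | p , refl | p′ , same-head = List.∷-injectiveˡ (f-injective p p′ (begin
      proj₁ (R.f (i ∷ w , q) p)                    ≡⟨ proj₂ (child↦child i w q p) ⟩
      _ ∷ proj₁ (R.f (w , _) (closed q p))         ≡⟨ cong₂ _∷_ (sym same-head) (cong proj₁ (f-cong refl _ _)) ⟩
      _ ∷ proj₁ (R.f (w , _) (closed q p′))        ≡⟨ proj₂ (child↦child i′ w q p′) ⟨
      proj₁ (R.f (i′ ∷ w , q) p′)                  ∎))

    portrait : Words< d k → Permutation′ d
    portrait u = proj₁ (partialInjection-extends d (localPartial u) (localPartial-injective u))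

    extension : Aut d k
    extension = portraitAut portrait

    extension-agrees-on-words : ∀ w q (p : P (w , q)) → Relabel.relabel (labelling portrait) w ≡ proj₁ (R.f (w , q) p)
    extension-agrees-on-words [] _ p = sym (root↦root p)
    extension-agrees-on-words (i ∷ w) q p = trans
      (cong₂ _∷_ (trans (cong (_⟨$⟩ʳ i) (labelling-inner portrait w q))
                        (proj₂ (partialInjection-extends d _ (localPartial-injective (w , q))) (childHead-yes i w q _ p)))
                 (extension-agrees-on-words w _ (closed q p)))
      (sym (proj₂ (child↦child i w q p)))

    extension-agrees : ∀ x (p : P x) → Aut.fun extension x ≡ R.f x p
    extension-agrees (w , q) p = bounded-≡ (extension-agrees-on-words w q p)

    extension-reflects : ∀ x → Q (Aut.fun extension x) → P x
    extension-reflects x qx = subst P preimage≡x (R.g∈ _ qx)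
      where
      module β = Aut extension
      preimage≡x : R.g (β.fun x) qx ≡ x
      preimage≡x = begin
        R.g (β.fun x) qx                          ≡⟨ β.left _ ⟨
        β.inv (β.fun (R.g (β.fun x) qx))          ≡⟨ cong β.inv (extension-agrees _ (R.g∈ _ qx)) ⟩
        β.inv (R.f (R.g (β.fun x) qx) (R.g∈ _ qx)) ≡⟨ cong β.inv (R.fg _ qx) ⟩
        β.inv (β.fun x)                           ≡⟨ β.left x ⟩
        x                                         ∎

  module RootFixed (d≥2 : 2 ≤ d) (k≥1 : 1 ≤ k) where

    module Embedding (α : Aut d k) = RootedEmbedding {λ _ → ⊤} (λ _ _ → tt) (λ x _ → Aut.fun α x)
      (λ _ _ → aut-injective α) (λ _ _ → Equivalence.to (Aut.adj α _ _))
      (λ _ → aut-fixes-root d≥2 k≥1 α)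

    innerImage : Aut d k → Words< d k → Words< d k
    innerImage α (w , p) = proj₁ (Aut.fun α (w , ℕ.<⇒≤ p))
                         , subst (_< k) (sym (Embedding.length-preserved α w _ tt)) p

    localMap : Aut d k → Words< d k → Fin d → Fin d
    localMap α (w , p) i = proj₁ (Embedding.child↦child α i w p tt)

    localMap-spec : ∀ α {w p i j ws} → proj₁ (Aut.fun α (i ∷ w , p)) ≡ j ∷ ws → localMap α (w , p) i ≡ j
    localMap-spec α {w} {p} {i} eq = List.∷-injectiveˡ (trans (sym (proj₂ (Embedding.child↦child α i w p tt))) eq)

    localMap-inverseˡ : ∀ α u i → localMap (α ⁻¹ᵃ) (innerImage α u) (localMap α u i) ≡ i
    localMap-inverseˡ α (w , p) i = localMap-spec (α ⁻¹ᵃ) (begin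
      proj₁ (α.inv (localMap α (w , p) i ∷ w′ , p′))   ≡⟨ cong (proj₁ ∘ α.inv) (bounded-≡ (sym eq)) ⟩
      proj₁ (α.inv (α.fun (i ∷ w , p)))               ≡⟨ cong proj₁ (α.left _) ⟩
      i ∷ w                                           ∎)
      where
      module α = Aut α
      w′ : Word d
      w′ = proj₁ (innerImage α (w , p))
      p′ : length w′ < k
      p′ = proj₂ (innerImage α (w , p))
      eq : proj₁ (α.fun (i ∷ w , p)) ≡ localMap α (w , p) i ∷ w′
      eq = proj₂ (Embedding.child↦child α i w p tt)

    localMap-inverseʳ : ∀ α u j → localMap α u (localMap (α ⁻¹ᵃ) (innerImage α u) j) ≡ j
    localMap-inverseʳ α (w , p) j = localMap-spec α (begin
      proj₁ (α.fun (i ∷ w , p))                ≡⟨ cong (proj₁ ∘ α.fun) (bounded-≡ (sym preimage)) ⟩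
      proj₁ (α.fun (α.inv (j ∷ w′ , p′)))       ≡⟨ cong proj₁ (α.right _) ⟩
      j ∷ w′                                   ∎)
      where
      module α = Aut α
      w′ : Word d
      w′ = proj₁ (innerImage α (w , p))
      p′ : length w′ < k
      p′ = proj₂ (innerImage α (w , p))
      i : Fin d
      i = localMap (α ⁻¹ᵃ) (w′ , p′) j
      preimage : proj₁ (α.inv (j ∷ w′ , p′)) ≡ i ∷ w
      preimage = trans (proj₂ (Embedding.child↦child (α ⁻¹ᵃ) j w′ p′ tt))
                       (cong (i ∷_) (cong proj₁ (trans (cong α.inv (bounded-≡ refl)) (α.left _))))

    localPerm : Aut d k → Words< d k → Permutation′ d
    localPerm α u = Perm.permutation (localMap α u) (localMap (α ⁻¹ᵃ) (innerImage α u))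
                                     (localMap-inverseʳ α u) (localMap-inverseˡ α u)

    relabel-localPerm : ∀ α w q → Relabel.relabel (labelling (localPerm α)) w ≡ proj₁ (Aut.fun α (w , q))
    relabel-localPerm α [] _ = sym (aut-fixes-root d≥2 k≥1 α)
    relabel-localPerm α (i ∷ w) q = trans
      (cong₂ _∷_ (cong (_⟨$⟩ʳ i) (labelling-inner (localPerm α) w q)) (relabel-localPerm α w _))
      (sym (proj₂ (Embedding.child↦child α i w q tt)))

    aut↔portrait : Inverse AutSetoid Portrait
    aut↔portrait = mkInverse localPerm portraitAut
      (λ {α} {α′} eq (w , p) i → sym (localMap-spec α′ (trans (cong proj₁ (sym (eq (i ∷ w , p))))
                                                               (proj₂ (Embedding.child↦child α i w p tt)))))
      (λ {q} {q′} eq (w , p) → bounded-≡ (relabel-cong (λ w′ p′ i → begin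
                 labelling q w′ ⟨$⟩ʳ i    ≡⟨ cong (_⟨$⟩ʳ i) (labelling-inner q w′ p′) ⟩
                 q (w′ , p′) ⟨$⟩ʳ i       ≡⟨ eq (w′ , p′) i ⟩
                 q′ (w′ , p′) ⟨$⟩ʳ i      ≡⟨ cong (_⟨$⟩ʳ i) (labelling-inner q′ w′ p′) ⟨
                 labelling q′ w′ ⟨$⟩ʳ i   ∎) w p))
      (λ q (w , p) i → localMap-spec (portraitAut q) {w} {p} {i}
                         (cong (_∷ Relabel.relabel (labelling q) w) (cong (_⟨$⟩ʳ i) (labelling-inner q w p))))
      (λ α (w , p) → bounded-≡ (relabel-localPerm α w p))

    aut-↔Fin : AutSetoid ↔Fin (d !) ^ geom d k
    aut-↔Fin = portrait-↔Fin ∘↔ aut↔portrait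

-- The orbit and the stabilizer of Γ

module OrbitStabilizer (d k : ℕ) (d≥2 : 2 ≤ d) (k≥1 : 1 ≤ k) (Γ : Vert d k → Bool) where
  open Automorphisms d k
  open RootFixed d≥2 k≥1

  InOrbit : (V → Bool) → Set
  InOrbit S = Σ (Aut d k) λ β → ∀ x → Γ (Aut.fun β x) ≡ S x

  Orbit : Setoid _ _
  Orbit = Subsetoid (V ⇒ₛ setoid Bool) InOrbit

  Stabilizes : Aut d k → Set
  Stabilizes α = ∀ x → Γ (Aut.fun α x) ≡ Γ x

  pointwise-Bool? : (S S′ : V → Bool) → Dec (∀ x → S x ≡ S′ x)
  pointwise-Bool? S S′ = all?-↔Fin (vert-↔Fin d k) (λ x → S x Bool.≟ S′ x)

  orbit-↔Fin : ∃ λ e → Orbit ↔Fin e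
  orbit-↔Fin = subset-↔Fin (V ⇒ₛ setoid Bool) (λ eq (β , h) → β , λ x → trans (h x) (eq x))
    (λ S → any?-↔Fin AutSetoid (λ eq h x → trans (cong Γ (sym (eq x))) (h x))
                     (λ β → pointwise-Bool? (Γ ∘ Aut.fun β) S) aut-↔Fin)
    (⇒ₛ-↔Fin (vert-↔Fin d k) (Sym.inverse Fin.2↔Bool))

  stabilizer-↔Fin : ∃ λ s → St d k Γ ↔Fin s
  stabilizer-↔Fin = subset-↔Fin AutSetoid (λ eq h x → trans (cong Γ (sym (eq x))) (h x))
    (λ α → pointwise-Bool? (Γ ∘ Aut.fun α) Γ) aut-↔Fin

  -- Each orbit element is Γ ∘ β for a chosen β; then α ↦ (Γ ∘ α , α ∘ β⁻¹) splits Aut.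
  module _ {e} (orbit : Orbit ↔Fin e) where
    private module orbit = Inverse orbit

    orbitOf : Aut d k → Setoid.Carrier Orbit
    orbitOf α = Γ ∘ Aut.fun α , α , λ _ → refl

    representative : Fin e → Aut d k
    representative j = proj₁ (proj₂ (orbit.from j))

    representative-spec : ∀ j x → Γ (Aut.fun (representative j) x) ≡ proj₁ (orbit.from j) x
    representative-spec j = proj₂ (proj₂ (orbit.from j))

    toStabilizer : Aut d k → Setoid.Carrier (St d k Γ)
    toStabilizer α = α ∘ᵃ β ⁻¹ᵃ , λ x → begin
      Γ (Aut.fun α (Aut.inv β x))          ≡⟨ orbit.strictlyInverseʳ (orbitOf α) (Aut.inv β x) ⟨
      proj₁ (orbit.from j) (Aut.inv β x)   ≡⟨ representative-spec j (Aut.inv β x) ⟨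
      Γ (Aut.fun β (Aut.inv β x))          ≡⟨ cong Γ (Aut.right β x) ⟩
      Γ x                                  ∎
      where j : Fin e
            j = orbit.to (orbitOf α)
            β : Aut d k
            β = representative j

    index-representative : ∀ j (γ : Aut d k) → Stabilizes γ → orbit.to (orbitOf (γ ∘ᵃ representative j)) ≡ j
    index-representative j γ γ-stab = trans
      (orbit.to-cong {orbitOf (γ ∘ᵃ representative j)} {orbit.from j}
                     (λ x → trans (γ-stab _) (representative-spec j x)))
      (orbit.strictlyInverseˡ j)

    aut↔orbit×stabilizer : Inverse AutSetoid (setoid (Fin e) ×ₛ St d k Γ)
    aut↔orbit×stabilizer = mkInverse (λ α → orbit.to (orbitOf α) , toStabilizer α)
      (λ (j , γ , _) → γ ∘ᵃ representative j)
      (λ {α} {α′} eq → let same-index = orbit.to-cong {orbitOf α} {orbitOf α′} (cong Γ ∘ eq) in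
         same-index , λ x → trans (eq _) (cong (λ j → Aut.fun α′ (Aut.inv (representative j) x)) same-index))
      (λ { {j , γ , _} (refl , eq) x → eq _ })
      (λ (j , γ , γ-stab) → let same-index = index-representative j γ γ-stab in same-index , λ x → begin
         Aut.fun γ (Aut.fun (representative j) (Aut.inv (representative _) x))
           ≡⟨ cong (λ j′ → Aut.fun γ (Aut.fun (representative j) (Aut.inv (representative j′) x))) same-index ⟩
         Aut.fun γ (Aut.fun (representative j) (Aut.inv (representative j) x))
           ≡⟨ cong (Aut.fun γ) (Aut.right (representative j) x) ⟩
         Aut.fun γ x ∎)
      (λ α x → cong (Aut.fun α) (Aut.left (representative (orbit.to (orbitOf α))) x))

  orbit-stabilizer : ∀ {e s} → Orbit ↔Fin e → St d k Γ ↔Fin s → e * s ≡ (d !) ^ geom d k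
  orbit-stabilizer orbit stabilizer =
    ↔Fin-unique (×-↔Fin (Id.inverse _) stabilizer ∘↔ aut↔orbit×stabilizer orbit) aut-↔Fin

-- Idempotents of D_Γ

T-injective : ∀ {a b} → T a ⇔ T b → a ≡ b
T-injective h = Bool.⇔→≡ (Bool.T-≡ ⇔-∘ (h ⇔-∘ ⇔-sym Bool.T-≡))

module PartialIdentities (d k : ℕ) where

  Dom? : (σ : PMap d k) → Decidable (Dom d k σ)
  Dom? σ x with σ x
  ... | just y = yes (y , refl)
  ... | nothing = no λ ()

  Dom-irrelevant : ∀ {σ : PMap d k} {x} → Irrelevant (Dom d k σ x)
  Dom-irrelevant = is-just-irrelevant
    where is-just-irrelevant : ∀ {A : Set} {m : Maybe A} → Irrelevant (∃ λ y → m ≡ just y)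
          is-just-irrelevant (y , refl) (.y , refl) = refl

  partialId : (Vert d k → Bool) → PMap d k
  partialId S x = if S x then just x else nothing

  partialId-just : ∀ S {x y} → partialId S x ≡ just y → y ≡ x
  partialId-just S {x} eq with S x
  partialId-just S refl | true = refl

  partialId-Dom : ∀ S {x} → Dom d k (partialId S) x ⇔ T (S x)
  partialId-Dom S {x} with S x
  ... | true = mk⇔ (λ _ → tt) (λ _ → x , refl)
  ... | false = mk⇔ (λ ()) (λ ())

  is-just-partialId : ∀ S x → is-just (partialId S x) ≡ S x
  is-just-partialId S x with S x
  ... | true = refl
  ... | false = refl

  partialId-idempotent : ∀ S → Idempotent d k (partialId S)
  partialId-idempotent S x with S x in eq
  ... | true rewrite eq = refl
  ... | false = refl

  partialId-IsPAutc : ∀ S → IsSubtree d k (Dom d k (partialId S)) → IsPAutc d k (partialId S)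
  partialId-IsPAutc S subtree = record
    { injective = λ x y z eq eq′ → trans (sym (partialId-just S eq)) (partialId-just S eq′)
    ; iso = λ x y x′ y′ eq eq′ → subst₂ (λ a b → Adj d k x y ⇔ Adj d k a b)
                                        (sym (partialId-just S eq)) (sym (partialId-just S eq′)) (mk⇔ id id)
    ; levelPres = λ x y eq → cong (level d k) (partialId-just S eq)
    ; domSub = subtree }

  idempotent-partialId : ∀ {σ} → IsPAutc d k σ → Idempotent d k σ → ∀ x → partialId (is-just ∘ σ) x ≡ σ x
  idempotent-partialId {σ} pa idem x with σ x in eq
  ... | nothing = refl
  ... | just y = cong just (sym (IsPAutc.injective pa y x y (trans (sym (cong (_>>= σ) eq)) (trans (idem x) eq)) eq))

  Dom⇔is-just : ∀ σ {x} → Dom d k σ x ⇔ T (is-just (σ x))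
  Dom⇔is-just σ {x} with σ x
  ... | just y = mk⇔ (λ _ → tt) (λ _ → y , refl)
  ... | nothing = mk⇔ (λ ()) (λ ())

module Idempotents (d k : ℕ) (d≥2 : 2 ≤ d) (k≥1 : 1 ≤ k) (Γ : Vert d k → Bool)
                   (Γ-subtree : IsSubtree d k (T ∘ Γ)) where
  open Automorphisms d k
  open RootFixed d≥2 k≥1
  open OrbitStabilizer d k d≥2 k≥1 Γ using (InOrbit; Orbit)
  open PartialIdentities d k

  domain-inOrbit : ∀ {σ} → InD d k Γ σ → InOrbit (is-just ∘ σ)
  domain-inOrbit {σ} (pa , R) = extension , λ x → T-injective (Dom⇔is-just σ ⇔-∘ mk⇔ (extension-reflects x)
      (λ p → subst (T ∘ Γ) (sym (extension-agrees x p)) (R.f∈ x p)))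
    where open ExtendRootedIso (Dom? σ) (Dom-irrelevant {σ}) Bool.T-irrelevant
                               (subtree-parentClosed (IsPAutc.domSub pa)) R

  module _ (S : V → Bool) (β : Aut d k) (β-spec : ∀ x → Γ (Aut.fun β x) ≡ S x) where
    private module β = Aut β

    Γ⇒Dom : ∀ {y} → T (Γ y) → Dom d k (partialId S) (β.inv y)
    Γ⇒Dom {y} t = Equivalence.from (partialId-Dom S) (subst T (trans (sym (cong Γ (β.right y))) (β-spec _)) t)

    Dom⇒Γ : ∀ {x} → Dom d k (partialId S) x → T (Γ (β.fun x))
    Dom⇒Γ {x} p = subst T (sym (β-spec x)) (Equivalence.to (partialId-Dom S) p)

    -- The domain of partialId S is the preimage of the subtree Γ under β.
    partialId-subtree : IsSubtree d k (Dom d k (partialId S))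
    partialId-subtree =
        subst (Dom d k (partialId S)) (bounded-≡ (aut-fixes-root d≥2 k≥1 (β ⁻¹ᵃ))) (Γ⇒Dom (proj₁ Γ-subtree))
      , λ x y px py → subst₂ (Walk d k _) (β.left x) (β.left y)
                        (walk-map (β ⁻¹ᵃ) Γ⇒Dom (proj₂ Γ-subtree _ _ (Dom⇒Γ px) (Dom⇒Γ py)))

    partialId-InD : InD d k Γ (partialId S)
    partialId-InD = partialId-IsPAutc S partialId-subtree , record
      { f = λ x _ → β.fun x ; f∈ = λ _ → Dom⇒Γ ; g = λ y _ → β.inv y ; g∈ = λ _ → Γ⇒Dom
      ; gf = λ x _ → β.left x ; fg = λ y _ → β.right y ; adj = λ x _ y _ → β.adj x y
      ; root↦ = λ _ → bounded-≡ (aut-fixes-root d≥2 k≥1 β) }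

  idempotents↔orbit : Inverse (E-D d k Γ) Orbit
  idempotents↔orbit = mkInverse
    (λ (σ , σ∈D , _) → is-just ∘ σ , domain-inOrbit σ∈D)
    (λ (S , β , β-spec) → partialId S , partialId-InD S β β-spec , partialId-idempotent S)
    (λ eq x → cong is-just (eq x))
    (λ eq x → cong (λ b → if b then just x else nothing) (eq x))
    (λ (S , _) → is-just-partialId S)
    (λ (σ , (pa , _) , idem) → idempotent-partialId pa idem)

mainTheorem10 : (d k : ℕ) → 2 ≤ d → 1 ≤ k →
    (Γ : Vert d k → Bool) → IsSubtree d k (λ x → T (Γ x)) →
    Σ[ e ∈ ℕ ] Σ[ s ∈ ℕ ]
      ( Inverse (E-D d k Γ) (setoid (Fin e))
      × Inverse (St d k Γ) (setoid (Fin s))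
      × e * s ≡ (d !) ^ geom d k )
mainTheorem10 d k d≥2 k≥1 Γ Γ-subtree =
  let (e , orbit) = orbit-↔Fin
      (s , stabilizer) = stabilizer-↔Fin
  in e , s , orbit ∘↔ idempotents↔orbit , stabilizer , orbit-stabilizer orbit stabilizer
  where
  open OrbitStabilizer d k d≥2 k≥1 Γ
  open Idempotents d k d≥2 k≥1 Γ Γ-subtree
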